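{- For every $n\ge0$, $$\sum_{k\ge0}2^k\,\mathrm{Der}(\mathrm{Sha})_{n,k}=\sum_{k\ge0}2^k\binom{2n-k+2}{n-k}=4^{n+1}-\binom{2n+3}{n+1}.$$
   Context: $C(t)=\frac{1-\sqrt{1-4t}}{2t}$ is the Catalan generating function. For formal power series $d(t),h(t)$ with $d(0)\neq0$, $h(0)=0$, $h'(0)\neq0$, $\mathcal{R}(d(t),h(t))$ is the infinite lower triangular matrix with $(n,k)$-entry $[t^n]\,d(t)h(t)^k$. $\mathrm{Sha}=\mathcal{R}(C(t),tC(t)^2)$ and $\mathrm{Der}(\mathcal{R}(d(t),h(t)))=\mathcal{R}(h'(t),t\,d(t))$, so $\mathrm{Der}(\mathrm{Sha})=\mathcal{R}(C'(t),tC(t))$. Binomial coefficients with negative lower index are $0$. -}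

module Defs where

open import Data.Nat using (ℕ; zero; suc; _+_; _*_; _∸_; _/_)
open import Data.Nat.Combinatorics using (_C_)
open import Data.List using (List; map; upTo)
open import Data.Nat.ListAction using (sum)

Series : Set
Series = ℕ → ℕ

Σ< : ℕ → (ℕ → ℕ) → ℕ
Σ< n f = sum (map f (upTo n))

one : Series
one zero    = 1
one (suc _) = 0

_⊛_ : Series → Series → Series
(f ⊛ g) n = Σ< (suc n) (λ i → f i * g (n ∸ i))

_^ₛ_ : Series → ℕ → Series
f ^ₛ zero  = one
f ^ₛ suc k = f ⊛ (f ^ₛ k)

tₓ : Series → Series
tₓ f zero    = 0
tₓ f (suc n) = f n

deriv : Series → Series
deriv f n = suc n * f (suc n)

-- Catalan generating function C(t) = (1 - √(1-4t))/(2t): [t^n] C = binom(2n,n)/(n+1)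
catalanGF : Series
catalanGF n = ((n + n) C n) / suc n

Riordan : Series → Series → ℕ → ℕ → ℕ
Riordan d h n k = (d ⊛ (h ^ₛ k)) n

-- Der(R(d,h)) = R(h'(t), t d(t)), given by the pair (d,h)
Der : Series → Series → ℕ → ℕ → ℕ
Der d h = Riordan (deriv h) (tₓ d)

-- Sha = R(C(t), t C(t)^2), so Der(Sha) = R(C'(t), t C(t))
DerSha : ℕ → ℕ → ℕ
DerSha = Der catalanGF (tₓ (catalanGF ⊛ catalanGF))

-- h = tC(t) satisfies h = t + h², so multiplying a column d·hᵏ of a Riordan array by h gives
-- t·d·hᵏ + d·hᵏ⁺², i.e. Pascal's rule R(n+1,k+1) = R(n,k) + R(n+1,k+2).  For Der(Sha) the
-- column 0 is C′(t), whose coefficients (n+1)·Cat(n+1) are binom(2n+2, n), and the entries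
-- above the diagonal vanish; these boundary values and Pascal's rule for binomials force
-- Der(Sha)(n,k) = binom(2n-k+2, n-k).  Unrolling the recursion for partial row sums shows
-- Σₖ 2ᵏ binom(a+m-k, m-k) = Σ_{j≤m} binom(a+m+1, j); for a = m+2 this is the lower half of
-- row 2m+3 without its last term binom(2m+3, m+1), and by the symmetry of that row its lower
-- half sums to 2^(2m+2) = 4^(m+1).

module Submission where

open import Defs
open import Data.Nat using (ℕ; zero; suc; _+_; _*_; _∸_; _^_; _≤_; _<_; z≤n; s≤s)
open import Data.Nat.Properties
open import Data.Nat.ListAction using (sum)
open import Data.Nat.ListAction.Properties using (sum-++)
open import Data.List using (map; upTo; _++_; [_])
open import Data.List.Properties using (map-++; upTo-∷ʳ; map-applyUpTo; map-upTo)
open import Data.Product using (_×_; _,_)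
open import Function using (_∘_)
open import Data.Nat.Combinatorics using (_C_; nCk+nC[k+1]≡[n+1]C[k+1]; k>n⇒nCk≡0; nC1≡n; nCk≡nC[n∸k])
open import Data.Nat.Divisibility using (divides)
open import Data.Nat.DivMod using (m*[n/m]≡n)
open import Data.Nat.Tactic.RingSolver using (solve-∀)
open import Relation.Binary.PropositionalEquality using (_≡_; _≗_; refl; sym; trans; cong; cong₂; module ≡-Reasoning)
open ≡-Reasoning
open import Algebra.Properties.CommutativeSemigroup +-commutativeSemigroup
  using () renaming (interchange to +-interchange; x∙yz≈y∙xz to x+[y+z]≡y+[x+z])
open import Algebra.Properties.CommutativeSemigroup *-commutativeSemigroup
  using () renaming (x∙yz≈y∙xz to x*[y*z]≡y*[x*z])

Σ<-sucˡ : ∀ n f → Σ< (suc n) f ≡ f 0 + Σ< n (f ∘ suc)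
Σ<-sucˡ n f = cong (λ xs → f 0 + sum xs) (trans (map-applyUpTo suc f n) (sym (map-upTo (f ∘ suc) n)))

Σ<-sucʳ : ∀ n f → Σ< (suc n) f ≡ Σ< n f + f n
Σ<-sucʳ n f = begin
  Σ< (suc n) f                     ≡⟨ cong (sum ∘ map f) (upTo-∷ʳ n) ⟨
  sum (map f (upTo n ++ [ n ]))    ≡⟨ cong sum (map-++ f (upTo n) [ n ]) ⟩
  sum (map f (upTo n) ++ [ f n ])  ≡⟨ sum-++ (map f (upTo n)) [ f n ] ⟩
  Σ< n f + (f n + 0)               ≡⟨ cong (Σ< n f +_) (+-identityʳ (f n)) ⟩
  Σ< n f + f n                     ∎

Σ<-cong : ∀ n {f g} → (∀ i → i < n → f i ≡ g i) → Σ< n f ≡ Σ< n g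
Σ<-cong zero    f≡g = refl
Σ<-cong (suc n) {f} {g} f≡g = begin
  Σ< (suc n) f  ≡⟨ Σ<-sucʳ n f ⟩
  Σ< n f + f n  ≡⟨ cong₂ _+_ (Σ<-cong n (λ i i<n → f≡g i (m<n⇒m<1+n i<n))) (f≡g n ≤-refl) ⟩
  Σ< n g + g n  ≡⟨ Σ<-sucʳ n g ⟨
  Σ< (suc n) g  ∎

Σ<-zero : ∀ n {f} → (∀ i → i < n → f i ≡ 0) → Σ< n f ≡ 0
Σ<-zero zero    f≡0 = refl
Σ<-zero (suc n) {f} f≡0 = begin
  Σ< (suc n) f  ≡⟨ Σ<-sucʳ n f ⟩
  Σ< n f + f n  ≡⟨ cong₂ _+_ (Σ<-zero n (λ i i<n → f≡0 i (m<n⇒m<1+n i<n))) (f≡0 n ≤-refl) ⟩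
  0             ∎

Σ<-distrib-+ : ∀ n f g → Σ< n (λ i → f i + g i) ≡ Σ< n f + Σ< n g
Σ<-distrib-+ zero    f g = refl
Σ<-distrib-+ (suc n) f g = begin
  Σ< (suc n) (λ i → f i + g i)         ≡⟨ Σ<-sucʳ n (λ i → f i + g i) ⟩
  Σ< n (λ i → f i + g i) + (f n + g n) ≡⟨ cong (_+ (f n + g n)) (Σ<-distrib-+ n f g) ⟩
  Σ< n f + Σ< n g + (f n + g n)        ≡⟨ +-interchange (Σ< n f) (Σ< n g) (f n) (g n) ⟩
  Σ< n f + f n + (Σ< n g + g n)        ≡⟨ cong₂ _+_ (Σ<-sucʳ n f) (Σ<-sucʳ n g) ⟨
  Σ< (suc n) f + Σ< (suc n) g          ∎

Σ<-distribˡ-* : ∀ n a f → Σ< n (λ i → a * f i) ≡ a * Σ< n f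
Σ<-distribˡ-* zero    a f = sym (*-zeroʳ a)
Σ<-distribˡ-* (suc n) a f = begin
  Σ< (suc n) (λ i → a * f i)     ≡⟨ Σ<-sucʳ n (λ i → a * f i) ⟩
  Σ< n (λ i → a * f i) + a * f n ≡⟨ cong (_+ a * f n) (Σ<-distribˡ-* n a f) ⟩
  a * Σ< n f + a * f n           ≡⟨ *-distribˡ-+ a (Σ< n f) (f n) ⟨
  a * (Σ< n f + f n)             ≡⟨ cong (a *_) (Σ<-sucʳ n f) ⟨
  a * Σ< (suc n) f               ∎

Σ<-reverse : ∀ n f → Σ< n f ≡ Σ< n (λ i → f (n ∸ suc i))
Σ<-reverse zero    f = refl
Σ<-reverse (suc n) f = begin
  Σ< (suc n) f                        ≡⟨ Σ<-sucʳ n f ⟩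
  Σ< n f + f n                        ≡⟨ cong (_+ f n) (Σ<-reverse n f) ⟩
  Σ< n (λ i → f (n ∸ suc i)) + f n    ≡⟨ +-comm _ (f n) ⟩
  f n + Σ< n (λ i → f (n ∸ suc i))    ≡⟨ Σ<-sucˡ n (λ i → f (n ∸ i)) ⟨
  Σ< (suc n) (λ i → f (suc n ∸ suc i)) ∎

Σ<-split : ∀ m n f → Σ< (m + n) f ≡ Σ< m f + Σ< n (λ i → f (m + i))
Σ<-split m zero    f = trans (cong (λ k → Σ< k f) (+-identityʳ m)) (sym (+-identityʳ (Σ< m f)))
Σ<-split m (suc n) f = begin
  Σ< (m + suc n) f                              ≡⟨ cong (λ k → Σ< k f) (+-suc m n) ⟩
  Σ< (suc (m + n)) f                            ≡⟨ Σ<-sucʳ (m + n) f ⟩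
  Σ< (m + n) f + f (m + n)                      ≡⟨ cong (_+ f (m + n)) (Σ<-split m n f) ⟩
  Σ< m f + Σ< n (λ i → f (m + i)) + f (m + n)   ≡⟨ +-assoc (Σ< m f) _ _ ⟩
  Σ< m f + (Σ< n (λ i → f (m + i)) + f (m + n)) ≡⟨ cong (Σ< m f +_) (Σ<-sucʳ n (λ i → f (m + i))) ⟨
  Σ< m f + Σ< (suc n) (λ i → f (m + i))         ∎

Σ<-weighted-palindrome : ∀ n (w a : ℕ → ℕ) K →
  (∀ i → i ≤ n → a (n ∸ i) ≡ a i) → (∀ i → i ≤ n → w i + w (n ∸ i) ≡ K) →
  Σ< (suc n) (λ i → w i * a i) + Σ< (suc n) (λ i → w i * a i) ≡ K * Σ< (suc n) a
Σ<-weighted-palindrome n w a K a-palindrome w-complement = begin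
  S + S                                              ≡⟨ cong (S +_) (Σ<-reverse (suc n) wa) ⟩
  S + Σ< (suc n) (λ i → w (n ∸ i) * a (n ∸ i))       ≡⟨ cong (S +_) (Σ<-cong (suc n) reflect) ⟩
  S + Σ< (suc n) (λ i → w (n ∸ i) * a i)             ≡⟨ Σ<-distrib-+ (suc n) wa (λ i → w (n ∸ i) * a i) ⟨
  Σ< (suc n) (λ i → w i * a i + w (n ∸ i) * a i)     ≡⟨ Σ<-cong (suc n) pair ⟩
  Σ< (suc n) (λ i → K * a i)                         ≡⟨ Σ<-distribˡ-* (suc n) K a ⟩
  K * Σ< (suc n) a                                   ∎
  where
  wa : ℕ → ℕ
  wa i = w i * a i
  S = Σ< (suc n) wa
  reflect : ∀ i → i < suc n → w (n ∸ i) * a (n ∸ i) ≡ w (n ∸ i) * a i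
  reflect i (s≤s i≤n) = cong (w (n ∸ i) *_) (a-palindrome i i≤n)
  pair : ∀ i → i < suc n → w i * a i + w (n ∸ i) * a i ≡ K * a i
  pair i (s≤s i≤n) = trans (sym (*-distribʳ-+ (a i) (w i) (w (n ∸ i)))) (cong (_* a i) (w-complement i i≤n))

infixl 6 _⊕_
infixr 7 _·_

_⊕_ : Series → Series → Series
(f ⊕ g) n = f n + g n

_·_ : ℕ → Series → Series
(a · f) n = a * f n

tₓ-cong : ∀ {f g} → f ≗ g → tₓ f ≗ tₓ g
tₓ-cong f≗g zero    = refl
tₓ-cong f≗g (suc n) = f≗g n

⊛-congˡ : ∀ {f f′} g → f ≗ f′ → f ⊛ g ≗ f′ ⊛ g
⊛-congˡ g f≗f′ n = Σ<-cong (suc n) (λ i _ → cong (_* g (n ∸ i)) (f≗f′ i))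

⊛-congʳ : ∀ f {g g′} → g ≗ g′ → f ⊛ g ≗ f ⊛ g′
⊛-congʳ f g≗g′ n = Σ<-cong (suc n) (λ i _ → cong (f i *_) (g≗g′ (n ∸ i)))

⊛-distribʳ-⊕ : ∀ f f′ g → (f ⊕ f′) ⊛ g ≗ f ⊛ g ⊕ f′ ⊛ g
⊛-distribʳ-⊕ f f′ g n = begin
  Σ< (suc n) (λ i → (f i + f′ i) * g (n ∸ i))
    ≡⟨ Σ<-cong (suc n) (λ i _ → *-distribʳ-+ (g (n ∸ i)) (f i) (f′ i)) ⟩
  Σ< (suc n) (λ i → f i * g (n ∸ i) + f′ i * g (n ∸ i))
    ≡⟨ Σ<-distrib-+ (suc n) (λ i → f i * g (n ∸ i)) (λ i → f′ i * g (n ∸ i)) ⟩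
  (f ⊛ g ⊕ f′ ⊛ g) n ∎

⊛-distribˡ-⊕ : ∀ f g g′ → f ⊛ (g ⊕ g′) ≗ f ⊛ g ⊕ f ⊛ g′
⊛-distribˡ-⊕ f g g′ n = begin
  Σ< (suc n) (λ i → f i * (g (n ∸ i) + g′ (n ∸ i)))
    ≡⟨ Σ<-cong (suc n) (λ i _ → *-distribˡ-+ (f i) (g (n ∸ i)) (g′ (n ∸ i))) ⟩
  Σ< (suc n) (λ i → f i * g (n ∸ i) + f i * g′ (n ∸ i))
    ≡⟨ Σ<-distrib-+ (suc n) (λ i → f i * g (n ∸ i)) (λ i → f i * g′ (n ∸ i)) ⟩
  (f ⊛ g ⊕ f ⊛ g′) n ∎

·-⊛ : ∀ a f g → (a · f) ⊛ g ≗ a · (f ⊛ g)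
·-⊛ a f g n = trans (Σ<-cong (suc n) (λ i _ → *-assoc a (f i) (g (n ∸ i))))
                    (Σ<-distribˡ-* (suc n) a (λ i → f i * g (n ∸ i)))

tₓ-⊛ : ∀ f g → tₓ f ⊛ g ≗ tₓ (f ⊛ g)
tₓ-⊛ f g zero    = refl
tₓ-⊛ f g (suc n) = Σ<-sucˡ (suc n) (λ i → tₓ f i * g (suc n ∸ i))

⊛-tₓ : ∀ f g → f ⊛ tₓ g ≗ tₓ (f ⊛ g)
⊛-tₓ f g zero    = trans (+-identityʳ (f 0 * 0)) (*-zeroʳ (f 0))
⊛-tₓ f g (suc n) = begin
  Σ< (suc (suc n)) (λ i → f i * tₓ g (suc n ∸ i))
    ≡⟨ Σ<-sucʳ (suc n) (λ i → f i * tₓ g (suc n ∸ i)) ⟩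
  Σ< (suc n) (λ i → f i * tₓ g (suc n ∸ i)) + f (suc n) * tₓ g (n ∸ n)
    ≡⟨ cong₂ _+_ (Σ<-cong (suc n) shift) (cong (λ m → f (suc n) * tₓ g m) (n∸n≡0 n)) ⟩
  (f ⊛ g) n + f (suc n) * 0 ≡⟨ cong ((f ⊛ g) n +_) (*-zeroʳ (f (suc n))) ⟩
  (f ⊛ g) n + 0             ≡⟨ +-identityʳ ((f ⊛ g) n) ⟩
  (f ⊛ g) n                 ∎
  where
  shift : ∀ i → i < suc n → f i * tₓ g (suc n ∸ i) ≡ f i * g (n ∸ i)
  shift i (s≤s i≤n) = cong (λ m → f i * tₓ g m) (+-∸-assoc 1 i≤n)

⊛-identityˡ : ∀ f → one ⊛ f ≗ f
⊛-identityˡ f n = begin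
  Σ< (suc n) (λ i → one i * f (n ∸ i)) ≡⟨ Σ<-sucˡ n (λ i → one i * f (n ∸ i)) ⟩
  1 * f n + Σ< n (λ _ → 0)             ≡⟨ cong₂ _+_ (*-identityˡ (f n)) (Σ<-zero n (λ _ _ → refl)) ⟩
  f n + 0                              ≡⟨ +-identityʳ (f n) ⟩
  f n                                  ∎

⊛-identityʳ : ∀ f → f ⊛ one ≗ f
⊛-identityʳ f n = begin
  Σ< (suc n) (λ i → f i * one (n ∸ i))      ≡⟨ Σ<-sucʳ n (λ i → f i * one (n ∸ i)) ⟩
  Σ< n (λ i → f i * one (n ∸ i)) + f n * one (n ∸ n)
    ≡⟨ cong₂ _+_ (Σ<-zero n off-diagonal) (cong (λ m → f n * one m) (n∸n≡0 n)) ⟩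
  f n * 1                                   ≡⟨ *-identityʳ (f n) ⟩
  f n                                       ∎
  where
  off-diagonal : ∀ i → i < n → f i * one (n ∸ i) ≡ 0
  off-diagonal i i<n = trans (cong (λ m → f i * one m) (+-∸-assoc 1 i<n)) (*-zeroʳ (f i))

⊛-unfoldˡ : ∀ f g → f ⊛ g ≗ f 0 · g ⊕ tₓ ((f ∘ suc) ⊛ g)
⊛-unfoldˡ f g zero    = refl
⊛-unfoldˡ f g (suc n) = Σ<-sucˡ (suc n) (λ i → f i * g (suc n ∸ i))

⊛-assoc : ∀ f g h → (f ⊛ g) ⊛ h ≗ f ⊛ (g ⊛ h)
⊛-assoc f g h n = begin
  ((f ⊛ g) ⊛ h) n                                   ≡⟨ ⊛-congˡ h (⊛-unfoldˡ f g) n ⟩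
  ((f 0 · g ⊕ tₓ ((f ∘ suc) ⊛ g)) ⊛ h) n            ≡⟨ ⊛-distribʳ-⊕ (f 0 · g) _ h n ⟩
  ((f 0 · g) ⊛ h) n + (tₓ ((f ∘ suc) ⊛ g) ⊛ h) n    ≡⟨ cong₂ _+_ (·-⊛ (f 0) g h n) (tₓ-⊛ ((f ∘ suc) ⊛ g) h n) ⟩
  f 0 * (g ⊛ h) n + tₓ (((f ∘ suc) ⊛ g) ⊛ h) n      ≡⟨ cong (f 0 * (g ⊛ h) n +_) (tail-assoc n) ⟩
  f 0 * (g ⊛ h) n + tₓ ((f ∘ suc) ⊛ (g ⊛ h)) n      ≡⟨ ⊛-unfoldˡ f (g ⊛ h) n ⟨
  (f ⊛ (g ⊛ h)) n                                   ∎
  where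
  tail-assoc : tₓ (((f ∘ suc) ⊛ g) ⊛ h) ≗ tₓ ((f ∘ suc) ⊛ (g ⊛ h))
  tail-assoc zero    = refl
  tail-assoc (suc m) = ⊛-assoc (f ∘ suc) g h m

⊛-vanishes : ∀ f g n → (∀ i → i ≤ n → g i ≡ 0) → (f ⊛ g) n ≡ 0
⊛-vanishes f g n g≡0 =
  Σ<-zero (suc n) (λ i _ → trans (cong (f i *_) (g≡0 (n ∸ i) (m∸n≤m n i))) (*-zeroʳ (f i)))

^ₛ-vanishes-below : ∀ {f} → f 0 ≡ 0 → ∀ k i → i < k → (f ^ₛ k) i ≡ 0
^ₛ-vanishes-below {f} f₀≡0 (suc k) i i<1+k = begin
  (f ⊛ (f ^ₛ k)) i                                      ≡⟨ ⊛-unfoldˡ f (f ^ₛ k) i ⟩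
  f 0 * (f ^ₛ k) i + tₓ ((f ∘ suc) ⊛ (f ^ₛ k)) i        ≡⟨ cong (λ a → a * (f ^ₛ k) i + tₓ ((f ∘ suc) ⊛ (f ^ₛ k)) i) f₀≡0 ⟩
  tₓ ((f ∘ suc) ⊛ (f ^ₛ k)) i                           ≡⟨ shifted i i<1+k ⟩
  0                                                   ∎
  where
  shifted : ∀ i → i < suc k → tₓ ((f ∘ suc) ⊛ (f ^ₛ k)) i ≡ 0
  shifted zero    _         = refl
  shifted (suc i) (s≤s i<k) =
    ⊛-vanishes (f ∘ suc) (f ^ₛ k) i (λ j j≤i → ^ₛ-vanishes-below f₀≡0 k j (≤-<-trans j≤i i<k))

Riordan-column₀ : ∀ d h n → Riordan d h n 0 ≡ d n
Riordan-column₀ d h = ⊛-identityʳ d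

Riordan-above-diagonal : ∀ d {h} → h 0 ≡ 0 → ∀ {n k} → n < k → Riordan d h n k ≡ 0
Riordan-above-diagonal d {h} h₀≡0 {n} {k} n<k =
  ⊛-vanishes d (h ^ₛ k) n (λ i i≤n → ^ₛ-vanishes-below h₀≡0 k i (≤-<-trans i≤n n<k))

⊛-quadraticˡ : ∀ {h} → h ≗ tₓ one ⊕ h ⊛ h → ∀ g → h ⊛ g ≗ tₓ g ⊕ h ⊛ (h ⊛ g)
⊛-quadraticˡ {h} h≗t+h² g n = begin
  (h ⊛ g) n                                ≡⟨ ⊛-congˡ g h≗t+h² n ⟩
  ((tₓ one ⊕ h ⊛ h) ⊛ g) n                 ≡⟨ ⊛-distribʳ-⊕ (tₓ one) (h ⊛ h) g n ⟩
  (tₓ one ⊛ g) n + ((h ⊛ h) ⊛ g) n         ≡⟨ cong₂ _+_ (tₓ-⊛ one g n) (⊛-assoc h h g n) ⟩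
  tₓ (one ⊛ g) n + (h ⊛ (h ⊛ g)) n         ≡⟨ cong (_+ (h ⊛ (h ⊛ g)) n) (tₓ-cong (⊛-identityˡ g) n) ⟩
  tₓ g n + (h ⊛ (h ⊛ g)) n                 ∎

Riordan-recurrence : ∀ d {h} → h ≗ tₓ one ⊕ h ⊛ h → ∀ n k →
  Riordan d h (suc n) (suc k) ≡ Riordan d h n k + Riordan d h (suc n) (suc (suc k))
Riordan-recurrence d {h} h≗t+h² n k = begin
  (d ⊛ (h ⊛ hᵏ)) (suc n)                                ≡⟨ ⊛-congʳ d (⊛-quadraticˡ h≗t+h² hᵏ) (suc n) ⟩
  (d ⊛ (tₓ hᵏ ⊕ h ⊛ (h ⊛ hᵏ))) (suc n)                  ≡⟨ ⊛-distribˡ-⊕ d (tₓ hᵏ) (h ⊛ (h ⊛ hᵏ)) (suc n) ⟩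
  (d ⊛ tₓ hᵏ) (suc n) + (d ⊛ (h ⊛ (h ⊛ hᵏ))) (suc n)   ≡⟨ cong (_+ (d ⊛ (h ⊛ (h ⊛ hᵏ))) (suc n)) (⊛-tₓ d hᵏ (suc n)) ⟩
  (d ⊛ hᵏ) n + (d ⊛ (h ⊛ (h ⊛ hᵏ))) (suc n)            ∎
  where
  hᵏ : Series
  hᵏ = h ^ₛ k

[k+1]*[n+1]C[k+1]≡[n+1]*nCk : ∀ n k → suc k * (suc n C suc k) ≡ suc n * (n C k)
[k+1]*[n+1]C[k+1]≡[n+1]*nCk zero    zero    = refl
[k+1]*[n+1]C[k+1]≡[n+1]*nCk zero    (suc k) =
  trans (cong (suc (suc k) *_) (k>n⇒nCk≡0 (s≤s (s≤s (z≤n {k}))))) (*-zeroʳ (suc (suc k)))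
[k+1]*[n+1]C[k+1]≡[n+1]*nCk (suc m) zero    =
  trans (+-identityʳ (suc (suc m) C 1)) (trans (nC1≡n (suc (suc m))) (sym (*-identityʳ (suc (suc m)))))
[k+1]*[n+1]C[k+1]≡[n+1]*nCk (suc m) (suc k) = begin
  suc (suc k) * (suc (suc m) C suc (suc k))  ≡⟨ cong (suc (suc k) *_) (nCk+nC[k+1]≡[n+1]C[k+1] (suc m) (suc k)) ⟨
  suc (suc k) * (x + y)                      ≡⟨ expand (suc k) x y ⟩
  x + (suc k * x + suc (suc k) * y)
    ≡⟨ cong (x +_) (cong₂ _+_ ([k+1]*[n+1]C[k+1]≡[n+1]*nCk m k) ([k+1]*[n+1]C[k+1]≡[n+1]*nCk m (suc k))) ⟩
  x + (suc m * (m C k) + suc m * (m C suc k)) ≡⟨ cong (x +_) (*-distribˡ-+ (suc m) (m C k) (m C suc k)) ⟨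
  x + suc m * (m C k + m C suc k)            ≡⟨ cong (λ z → x + suc m * z) (nCk+nC[k+1]≡[n+1]C[k+1] m k) ⟩
  x + suc m * x                              ∎
  where
  x = suc m C suc k
  y = suc m C suc (suc k)
  expand : ∀ a b c → suc a * (b + c) ≡ b + (a * b + suc a * c)
  expand = solve-∀

[k+1]*[k+l]C[k+1]≡l*[k+l]Ck : ∀ k l → suc k * ((k + l) C suc k) ≡ l * ((k + l) C k)
[k+1]*[k+l]C[k+1]≡l*[k+l]Ck k l = +-cancelˡ-≡ (suc k * x) _ _ (begin
  suc k * x + suc k * y    ≡⟨ *-distribˡ-+ (suc k) x y ⟨
  suc k * (x + y)          ≡⟨ cong (suc k *_) (nCk+nC[k+1]≡[n+1]C[k+1] (k + l) k) ⟩
  suc k * (suc (k + l) C suc k) ≡⟨ [k+1]*[n+1]C[k+1]≡[n+1]*nCk (k + l) k ⟩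
  suc (k + l) * x          ≡⟨ split-factor k l x ⟩
  suc k * x + l * x        ∎)
  where
  x = (k + l) C k
  y = (k + l) C suc k
  split-factor : ∀ a b c → suc (a + b) * c ≡ suc a * c + b * c
  split-factor = solve-∀

-- catalanGF truncates the division; it is exact because (n+1)·(binom(2n,n) - binom(2n,n+1)) = binom(2n,n).
[n+1]*catalanGF[n]≡[n+n]Cn : ∀ n → suc n * catalanGF n ≡ (n + n) C n
[n+1]*catalanGF[n]≡[n+n]Cn n = m*[n/m]≡n (divides (x ∸ y) (sym (trans (*-comm (x ∸ y) (suc n)) [n+1]*[x∸y]≡x)))
  where
  x = (n + n) C n
  y = (n + n) C suc n
  [n+1]*[x∸y]≡x : suc n * (x ∸ y) ≡ x
  [n+1]*[x∸y]≡x = begin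
    suc n * (x ∸ y)         ≡⟨ *-distribˡ-∸ (suc n) x y ⟩
    suc n * x ∸ suc n * y   ≡⟨ cong (suc n * x ∸_) ([k+1]*[k+l]C[k+1]≡l*[k+l]Ck n n) ⟩
    x + n * x ∸ n * x       ≡⟨ m+n∸n≡m x (n * x) ⟩
    x                       ∎

catalanGF-recurrence : ∀ n → suc (suc n) * catalanGF (suc n) ≡ 2 * suc (n + n) * catalanGF n
catalanGF-recurrence n = *-cancelˡ-≡ _ _ (suc n) (begin
  suc n * (suc (suc n) * catalanGF (suc n))  ≡⟨ cong (suc n *_) ([n+1]*catalanGF[n]≡[n+n]Cn (suc n)) ⟩
  suc n * ((suc n + suc n) C suc n)          ≡⟨ cong (λ m → suc n * (m C suc n)) (cong suc (+-suc n n)) ⟩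
  suc n * (suc (suc (n + n)) C suc n)        ≡⟨ cong (suc n *_) (nCk+nC[k+1]≡[n+1]C[k+1] (suc (n + n)) n) ⟨
  suc n * (u + v)                            ≡⟨ cong (λ z → suc n * (z + v)) u≡v ⟩
  suc n * (v + v)                            ≡⟨ *-distribˡ-+ (suc n) v v ⟩
  suc n * v + suc n * v                      ≡⟨ cong₂ _+_ [n+1]*v≡[2n+1]*x [n+1]*v≡[2n+1]*x ⟩
  suc (n + n) * x + suc (n + n) * x          ≡⟨ cong (λ z → suc (n + n) * z + suc (n + n) * z) ([n+1]*catalanGF[n]≡[n+n]Cn n) ⟨
  suc (n + n) * (suc n * c) + suc (n + n) * (suc n * c) ≡⟨ rearrange (suc n) (suc (n + n)) c ⟩
  suc n * (2 * suc (n + n) * c)              ∎)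
  where
  c = catalanGF n
  x = (n + n) C n
  u = suc (n + n) C n
  v = suc (n + n) C suc n
  u≡v : u ≡ v
  u≡v = sym (trans (nCk≡nC[n∸k] (s≤s (m≤m+n n n))) (cong (suc (n + n) C_) (m+n∸m≡n n n)))
  [n+1]*v≡[2n+1]*x : suc n * v ≡ suc (n + n) * x
  [n+1]*v≡[2n+1]*x = [k+1]*[n+1]C[k+1]≡[n+1]*nCk (n + n) n
  rearrange : ∀ a b c → b * (a * c) + b * (a * c) ≡ a * (2 * b * c)
  rearrange = solve-∀

[n+1]*catalanGF[n+1]≡[2+n+n]Cn : ∀ n → suc n * catalanGF (suc n) ≡ (2 + (n + n)) C n
[n+1]*catalanGF[n+1]≡[2+n+n]Cn n = *-cancelˡ-≡ _ _ (suc (suc n)) (begin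
  suc (suc n) * (suc n * catalanGF (suc n))  ≡⟨ x*[y*z]≡y*[x*z] (suc (suc n)) (suc n) (catalanGF (suc n)) ⟩
  suc n * (suc (suc n) * catalanGF (suc n))  ≡⟨ cong (suc n *_) ([n+1]*catalanGF[n]≡[n+n]Cn (suc n)) ⟩
  suc n * ((suc n + suc n) C suc n)          ≡⟨ cong (λ m → suc n * (m C suc n)) (+-suc n (suc n)) ⟨
  suc n * ((n + suc (suc n)) C suc n)        ≡⟨ [k+1]*[k+l]C[k+1]≡l*[k+l]Ck n (suc (suc n)) ⟩
  suc (suc n) * ((n + suc (suc n)) C n)
    ≡⟨ cong (λ m → suc (suc n) * (m C n)) (trans (+-suc n (suc n)) (cong suc (+-suc n n))) ⟩
  suc (suc n) * ((2 + (n + n)) C n)          ∎)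

-- Weighting the terms c(i)c(n-i) by i+1 and pairing i with n-i gives
-- 2T = (n+2)·(c ⊛ c)(n); the ratio recurrence rewrites T as c(n) + 2V with V the (2j+1)-weighted
-- convolution at n-1, which pairs up the same way.
catalanGF-convolution : ∀ n → (catalanGF ⊛ catalanGF) n ≡ catalanGF (suc n)
catalanGF-convolution zero    = refl
catalanGF-convolution (suc m) = *-cancelˡ-≡ _ _ (suc (suc n)) (begin
  suc (suc n) * (c ⊛ c) n                        ≡⟨ T+T≡[n+2]*[c⊛c][n] ⟨
  T + T                                          ≡⟨ cong₂ _+_ T≡c[n]+2V T≡c[n]+2V ⟩
  (c n + 2 * V) + (c n + 2 * V)                  ≡⟨ regroup (c n) V ⟩
  c n + c n + 2 * (V + V)                        ≡⟨ cong (λ z → c n + c n + 2 * z) V+V≡[2m+2]*[c⊛c][m] ⟩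
  c n + c n + 2 * ((2 + (m + m)) * (c ⊛ c) m)    ≡⟨ cong (λ z → c n + c n + 2 * ((2 + (m + m)) * z)) (catalanGF-convolution m) ⟩
  c n + c n + 2 * ((2 + (m + m)) * c n)          ≡⟨ collect m (c n) ⟩
  2 * suc (n + n) * c n                          ≡⟨ catalanGF-recurrence n ⟨
  suc (suc n) * c (suc n)                        ∎)
  where
  n = suc m
  c = catalanGF
  cc : ℕ → ℕ → ℕ
  cc n i = c i * c (n ∸ i)
  cc-palindrome : ∀ n i → i ≤ n → cc n (n ∸ i) ≡ cc n i
  cc-palindrome n i i≤n = trans (cong (λ j → c (n ∸ i) * c j) (m∸[m∸n]≡n i≤n)) (*-comm (c (n ∸ i)) (c i))
  weights-n : ∀ i → i ≤ n → suc i + suc (n ∸ i) ≡ suc (suc n)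
  weights-n i i≤n = cong suc (trans (+-suc i (n ∸ i)) (cong suc (m+[n∸m]≡n i≤n)))
  weights-m : ∀ j → j ≤ m → suc (j + j) + suc ((m ∸ j) + (m ∸ j)) ≡ 2 + (m + m)
  weights-m j j≤m = trans (twice j (m ∸ j)) (cong (λ k → 2 + (k + k)) (m+[n∸m]≡n j≤m))
    where
    twice : ∀ a b → suc (a + a) + suc (b + b) ≡ 2 + ((a + b) + (a + b))
    twice = solve-∀
  T V : ℕ
  T = Σ< (suc n) (λ i → suc i * cc n i)
  V = Σ< (suc m) (λ j → suc (j + j) * cc m j)
  T+T≡[n+2]*[c⊛c][n] : T + T ≡ suc (suc n) * (c ⊛ c) n
  T+T≡[n+2]*[c⊛c][n] = Σ<-weighted-palindrome n suc (cc n) (suc (suc n)) (cc-palindrome n) weights-n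
  V+V≡[2m+2]*[c⊛c][m] : V + V ≡ (2 + (m + m)) * (c ⊛ c) m
  V+V≡[2m+2]*[c⊛c][m] = Σ<-weighted-palindrome m (λ j → suc (j + j)) (cc m) (2 + (m + m)) (cc-palindrome m) weights-m
  T≡c[n]+2V : T ≡ c n + 2 * V
  T≡c[n]+2V = begin
    T                                                      ≡⟨ Σ<-sucˡ n (λ i → suc i * cc n i) ⟩
    1 * (1 * c n) + Σ< (suc m) (λ j → suc (suc j) * (c (suc j) * c (m ∸ j)))
      ≡⟨ cong₂ _+_ (trans (*-identityˡ (1 * c n)) (*-identityˡ (c n))) (Σ<-cong (suc m) (λ j _ → halve j)) ⟩
    c n + Σ< (suc m) (λ j → 2 * (suc (j + j) * cc m j))
      ≡⟨ cong (c n +_) (Σ<-distribˡ-* (suc m) 2 (λ j → suc (j + j) * cc m j)) ⟩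
    c n + 2 * V                                            ∎
    where
    halve : ∀ j → suc (suc j) * (c (suc j) * c (m ∸ j)) ≡ 2 * (suc (j + j) * cc m j)
    halve j = begin
      suc (suc j) * (c (suc j) * c (m ∸ j))   ≡⟨ *-assoc (suc (suc j)) (c (suc j)) (c (m ∸ j)) ⟨
      suc (suc j) * c (suc j) * c (m ∸ j)     ≡⟨ cong (_* c (m ∸ j)) (catalanGF-recurrence j) ⟩
      2 * suc (j + j) * c j * c (m ∸ j)       ≡⟨ reassoc 2 (suc (j + j)) (c j) (c (m ∸ j)) ⟩
      2 * (suc (j + j) * (c j * c (m ∸ j)))   ∎
      where
      reassoc : ∀ a b x y → a * b * x * y ≡ a * (b * (x * y))
      reassoc = solve-∀
  regroup : ∀ a b → (a + 2 * b) + (a + 2 * b) ≡ a + a + 2 * (b + b)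
  regroup = solve-∀
  collect : ∀ m x → x + x + 2 * ((2 + (m + m)) * x) ≡ 2 * suc (suc m + suc m) * x
  collect = solve-∀

catalanGF-functional : catalanGF ≗ one ⊕ tₓ (catalanGF ⊛ catalanGF)
catalanGF-functional zero    = refl
catalanGF-functional (suc n) = sym (catalanGF-convolution n)

tₓcatalanGF-quadratic : tₓ catalanGF ≗ tₓ one ⊕ tₓ catalanGF ⊛ tₓ catalanGF
tₓcatalanGF-quadratic zero    = refl
tₓcatalanGF-quadratic (suc n) = begin
  catalanGF n                              ≡⟨ catalanGF-functional n ⟩
  one n + tₓ (catalanGF ⊛ catalanGF) n     ≡⟨ cong (one n +_) (⊛-tₓ catalanGF catalanGF n) ⟨
  one n + (catalanGF ⊛ tₓ catalanGF) n     ≡⟨ cong (one n +_) (tₓ-⊛ catalanGF (tₓ catalanGF) (suc n)) ⟨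
  one n + (tₓ catalanGF ⊛ tₓ catalanGF) (suc n) ∎

DerSha-column₀ : ∀ n → DerSha n 0 ≡ (2 + (n + n)) C n
DerSha-column₀ n = begin
  DerSha n 0                                 ≡⟨ Riordan-column₀ (deriv (tₓ (catalanGF ⊛ catalanGF))) (tₓ catalanGF) n ⟩
  suc n * (catalanGF ⊛ catalanGF) n          ≡⟨ cong (suc n *_) (catalanGF-convolution n) ⟩
  suc n * catalanGF (suc n)                  ≡⟨ [n+1]*catalanGF[n+1]≡[2+n+n]Cn n ⟩
  (2 + (n + n)) C n                          ∎

DerSha-recurrence : ∀ n k → DerSha (suc n) (suc k) ≡ DerSha n k + DerSha (suc n) (suc (suc k))
DerSha-recurrence = Riordan-recurrence (deriv (tₓ (catalanGF ⊛ catalanGF))) tₓcatalanGF-quadratic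

DerSha-above-diagonal : ∀ {n k} → n < k → DerSha n k ≡ 0
DerSha-above-diagonal = Riordan-above-diagonal (deriv (tₓ (catalanGF ⊛ catalanGF))) refl

DerSha[k+j,k] : ∀ k j → DerSha (k + j) k ≡ (2 + k + (j + j)) C j
DerSha[k+j,k] zero    j       = DerSha-column₀ j
DerSha[k+j,k] (suc k) zero    = begin
  DerSha (suc (k + 0)) (suc k)                         ≡⟨ DerSha-recurrence (k + 0) k ⟩
  DerSha (k + 0) k + DerSha (suc (k + 0)) (suc (suc k))
    ≡⟨ cong₂ _+_ (DerSha[k+j,k] k 0) (DerSha-above-diagonal (s≤s (s≤s (≤-reflexive (+-identityʳ k))))) ⟩
  1                                                    ∎
DerSha[k+j,k] (suc k) (suc j) = begin
  DerSha (suc (k + suc j)) (suc k)                                ≡⟨ DerSha-recurrence (k + suc j) k ⟩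
  DerSha (k + suc j) k + DerSha (suc (k + suc j)) (suc (suc k))
    ≡⟨ cong (λ m → DerSha (k + suc j) k + DerSha (suc m) (suc (suc k))) (+-suc k j) ⟩
  DerSha (k + suc j) k + DerSha (suc (suc k) + j) (suc (suc k))
    ≡⟨ cong₂ _+_ (DerSha[k+j,k] k (suc j)) (DerSha[k+j,k] (suc (suc k)) j) ⟩
  e C suc j + (2 + suc (suc k) + (j + j)) C j                     ≡⟨ cong (λ i → i C suc j + m C j) (reindex k j) ⟩
  m C suc j + m C j                                               ≡⟨ +-comm (m C suc j) (m C j) ⟩
  m C j + m C suc j                                               ≡⟨ nCk+nC[k+1]≡[n+1]C[k+1] m j ⟩
  suc m C suc j                                                   ≡⟨ cong (λ i → suc i C suc j) (reindex k j) ⟨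
  (2 + suc k + (suc j + suc j)) C suc j                           ∎
  where
  e = 2 + k + (suc j + suc j)
  m = 2 + suc (suc k) + (j + j)
  reindex : ∀ k j → 2 + k + (suc j + suc j) ≡ 2 + suc (suc k) + (j + j)
  reindex = solve-∀

DerSha-entry : ∀ {n k} → k ≤ n → DerSha n k ≡ ((n + n + 2) ∸ k) C (n ∸ k)
DerSha-entry {n} {k} k≤n = begin
  DerSha n k                                ≡⟨ cong (λ m → DerSha m k) (m+[n∸m]≡n k≤n) ⟨
  DerSha (k + j) k                          ≡⟨ DerSha[k+j,k] k j ⟩
  (2 + k + (j + j)) C j                     ≡⟨ cong (_C j) (m+n∸m≡n k (2 + k + (j + j))) ⟨
  (k + (2 + k + (j + j)) ∸ k) C j           ≡⟨ cong (λ m → (m ∸ k) C j) (regroup k j) ⟩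
  ((k + j) + (k + j) + 2 ∸ k) C j           ≡⟨ cong (λ m → (m + m + 2 ∸ k) C j) (m+[n∸m]≡n k≤n) ⟩
  ((n + n + 2) ∸ k) C j                     ∎
  where
  j = n ∸ k
  regroup : ∀ k j → k + (2 + k + (j + j)) ≡ (k + j) + (k + j) + 2
  regroup = solve-∀

binomialPrefixSum : ℕ → ℕ → ℕ
binomialPrefixSum N m = Σ< (suc m) (N C_)

binomialPrefixSum-suc : ∀ N m →
  binomialPrefixSum (suc N) (suc m) ≡ binomialPrefixSum N m + binomialPrefixSum N m + N C suc m
binomialPrefixSum-suc N m = begin
  binomialPrefixSum (suc N) (suc m)          ≡⟨ Σ<-sucˡ (suc m) (suc N C_) ⟩
  1 + Σ< (suc m) (λ j → suc N C suc j)       ≡⟨ cong (1 +_) (Σ<-cong (suc m) (λ j _ → nCk+nC[k+1]≡[n+1]C[k+1] N j)) ⟨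
  1 + Σ< (suc m) (λ j → N C j + N C suc j)   ≡⟨ cong (1 +_) (Σ<-distrib-+ (suc m) (N C_) (λ j → N C suc j)) ⟩
  1 + (P + Q)                                ≡⟨ x+[y+z]≡y+[x+z] 1 P Q ⟩
  P + (1 + Q)                                ≡⟨ cong (P +_) (trans (sym (Σ<-sucˡ (suc m) (N C_))) (Σ<-sucʳ (suc m) (N C_))) ⟩
  P + (P + N C suc m)                        ≡⟨ +-assoc P P (N C suc m) ⟨
  P + P + N C suc m                          ∎
  where
  P = binomialPrefixSum N m
  Q = Σ< (suc m) (λ j → N C suc j)

binomialPrefixSum[N,N]≡2^N : ∀ N → binomialPrefixSum N N ≡ 2 ^ N
binomialPrefixSum[N,N]≡2^N zero    = refl
binomialPrefixSum[N,N]≡2^N (suc N) = begin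
  binomialPrefixSum (suc N) (suc N)                              ≡⟨ binomialPrefixSum-suc N N ⟩
  binomialPrefixSum N N + binomialPrefixSum N N + N C suc N
    ≡⟨ cong₂ (λ a b → a + a + b) (binomialPrefixSum[N,N]≡2^N N) (k>n⇒nCk≡0 (n<1+n N)) ⟩
  2 ^ N + 2 ^ N + 0                                              ≡⟨ +-identityʳ (2 ^ N + 2 ^ N) ⟩
  2 ^ N + 2 ^ N                                                  ≡⟨ cong (2 ^ N +_) (+-identityʳ (2 ^ N)) ⟨
  2 * 2 ^ N                                                      ∎

Σ<-2^k*binomial≡binomialPrefixSum : ∀ a m →
  Σ< (suc m) (λ k → 2 ^ k * ((a + (m ∸ k)) C (m ∸ k))) ≡ binomialPrefixSum (suc (a + m)) m
Σ<-2^k*binomial≡binomialPrefixSum a zero    = refl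
Σ<-2^k*binomial≡binomialPrefixSum a (suc m) = begin
  Σ< (suc (suc m)) (λ k → 2 ^ k * ((a + (suc m ∸ k)) C (suc m ∸ k)))
    ≡⟨ Σ<-sucˡ (suc m) (λ k → 2 ^ k * ((a + (suc m ∸ k)) C (suc m ∸ k))) ⟩
  1 * ((a + suc m) C suc m) + Σ< (suc m) (λ k → 2 * 2 ^ k * ((a + (m ∸ k)) C (m ∸ k)))
    ≡⟨ cong₂ _+_ (trans (*-identityˡ ((a + suc m) C suc m)) (cong (_C suc m) (+-suc a m))) doubled ⟩
  suc (a + m) C suc m + (P + P)                   ≡⟨ +-comm (suc (a + m) C suc m) (P + P) ⟩
  P + P + suc (a + m) C suc m                     ≡⟨ binomialPrefixSum-suc (suc (a + m)) m ⟨
  binomialPrefixSum (suc (suc (a + m))) (suc m)   ≡⟨ cong (λ i → binomialPrefixSum (suc i) (suc m)) (+-suc a m) ⟨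
  binomialPrefixSum (suc (a + suc m)) (suc m)     ∎
  where
  P = binomialPrefixSum (suc (a + m)) m
  doubled : Σ< (suc m) (λ k → 2 * 2 ^ k * ((a + (m ∸ k)) C (m ∸ k))) ≡ P + P
  doubled = begin
    Σ< (suc m) (λ k → 2 * 2 ^ k * ((a + (m ∸ k)) C (m ∸ k)))
      ≡⟨ Σ<-cong (suc m) (λ k _ → *-assoc 2 (2 ^ k) ((a + (m ∸ k)) C (m ∸ k))) ⟩
    Σ< (suc m) (λ k → 2 * (2 ^ k * ((a + (m ∸ k)) C (m ∸ k))))
      ≡⟨ Σ<-distribˡ-* (suc m) 2 (λ k → 2 ^ k * ((a + (m ∸ k)) C (m ∸ k))) ⟩
    2 * Σ< (suc m) (λ k → 2 ^ k * ((a + (m ∸ k)) C (m ∸ k)))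
      ≡⟨ cong (2 *_) (Σ<-2^k*binomial≡binomialPrefixSum a m) ⟩
    2 * P ≡⟨ cong (P +_) (+-identityʳ P) ⟩
    P + P ∎

binomialPrefixSum[2h+1,h]≡4^h : ∀ h → binomialPrefixSum (suc (h + h)) h ≡ 4 ^ h
binomialPrefixSum[2h+1,h]≡4^h h = *-cancelˡ-≡ _ _ 2 (begin
  2 * P                                            ≡⟨ cong (P +_) (+-identityʳ P) ⟩
  P + P                                            ≡⟨ cong (P +_) upper-half ⟨
  P + Σ< (suc h) (λ i → N C (suc h + i))           ≡⟨ Σ<-split (suc h) (suc h) (N C_) ⟨
  Σ< (suc h + suc h) (N C_)                        ≡⟨ cong (λ m → Σ< (suc m) (N C_)) (+-suc h h) ⟩
  binomialPrefixSum N N                            ≡⟨ binomialPrefixSum[N,N]≡2^N N ⟩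
  2 * 2 ^ (h + h)                                  ≡⟨ cong (λ m → 2 * 2 ^ (h + m)) (+-identityʳ h) ⟨
  2 * 2 ^ (2 * h)                                  ≡⟨ cong (2 *_) (^-*-assoc 2 2 h) ⟨
  2 * 4 ^ h                                        ∎)
  where
  N = suc (h + h)
  P = binomialPrefixSum N h
  mirror : ∀ i → i < suc h → N C (suc h + (h ∸ i)) ≡ N C i
  mirror i (s≤s i≤h) = begin
    N C suc (h + (h ∸ i))   ≡⟨ cong (λ m → N C suc m) (+-∸-assoc h i≤h) ⟨
    N C suc (h + h ∸ i)     ≡⟨ cong (N C_) (+-∸-assoc 1 (≤-trans i≤h (m≤n+m h h))) ⟨
    N C (N ∸ i)             ≡⟨ nCk≡nC[n∸k] (≤-trans i≤h (m≤n+m h (suc h))) ⟨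
    N C i                   ∎
  upper-half : Σ< (suc h) (λ i → N C (suc h + i)) ≡ P
  upper-half = trans (Σ<-reverse (suc h) (λ i → N C (suc h + i))) (Σ<-cong (suc h) mirror)

Σ<-2^k*[2n+2∸k]C[n∸k]≡4^[n+1]∸[2n+3]C[n+1] : ∀ n →
  Σ< (suc n) (λ k → 2 ^ k * (((n + n + 2) ∸ k) C (n ∸ k))) ≡ 4 ^ (n + 1) ∸ ((n + n + 3) C (n + 1))
Σ<-2^k*[2n+2∸k]C[n∸k]≡4^[n+1]∸[2n+3]C[n+1] n = begin
  Σ< (suc n) (λ k → 2 ^ k * (((n + n + 2) ∸ k) C (n ∸ k)))
    ≡⟨ Σ<-cong (suc n) (λ k k<1+n → cong (λ m → 2 ^ k * (m C (n ∸ k))) (shift k (≤-pred k<1+n))) ⟩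
  Σ< (suc n) (λ k → 2 ^ k * ((2 + n + (n ∸ k)) C (n ∸ k)))     ≡⟨ Σ<-2^k*binomial≡binomialPrefixSum (2 + n) n ⟩
  P                                                            ≡⟨ m+n∸n≡m P M ⟨
  P + M ∸ M                                                    ≡⟨ cong₂ _∸_ P+M≡4^[n+1] (cong (N C_) (+-comm 1 n)) ⟩
  4 ^ (n + 1) ∸ (N C (n + 1))                                  ≡⟨ cong (λ m → 4 ^ (n + 1) ∸ (m C (n + 1))) N≡2n+3 ⟩
  4 ^ (n + 1) ∸ ((n + n + 3) C (n + 1))                        ∎
  where
  N = suc (2 + n + n)
  P = binomialPrefixSum N n
  M = N C suc n
  N≡2n+3 : N ≡ n + n + 3
  N≡2n+3 = +-comm 3 (n + n)
  shift : ∀ k → k ≤ n → (n + n + 2) ∸ k ≡ 2 + n + (n ∸ k)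
  shift k k≤n = trans (cong (_∸ k) (+-comm (n + n) 2)) (+-∸-assoc (2 + n) k≤n)
  P+M≡4^[n+1] : P + M ≡ 4 ^ (n + 1)
  P+M≡4^[n+1] = begin
    P + M                                     ≡⟨ Σ<-sucʳ (suc n) (N C_) ⟨
    binomialPrefixSum N (suc n)               ≡⟨ cong (λ m → binomialPrefixSum (suc m) (suc n)) (cong suc (+-suc n n)) ⟨
    binomialPrefixSum (suc (suc n + suc n)) (suc n) ≡⟨ binomialPrefixSum[2h+1,h]≡4^h (suc n) ⟩
    4 ^ suc n                                 ≡⟨ cong (4 ^_) (+-comm 1 n) ⟩
    4 ^ (n + 1)                               ∎

mainTheorem19 : (n : ℕ) →
    (Σ< (suc n) (λ k → 2 ^ k * DerSha n k)
      ≡ Σ< (suc n) (λ k → 2 ^ k * (((n + n + 2) ∸ k) C (n ∸ k))))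
    × (Σ< (suc n) (λ k → 2 ^ k * (((n + n + 2) ∸ k) C (n ∸ k)))
      ≡ 4 ^ (n + 1) ∸ ((n + n + 3) C (n + 1)))
mainTheorem19 n =
  Σ<-cong (suc n) (λ k k<1+n → cong (2 ^ k *_) (DerSha-entry (≤-pred k<1+n))) ,
  Σ<-2^k*[2n+2∸k]C[n∸k]≡4^[n+1]∸[2n+3]C[n+1] n
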